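{- Let $\mathcal C,\mathcal D$ be stable configuration structures. Then $\mathcal C$ and $\mathcal D$ are weak history-preserving (WH) bisimilar if and only if $\mathcal C\equiv_{\mathrm{EIL}_{wh}}\mathcal D$.
   Context: Configuration structures. A configuration structure over $\mathsf{Act}$ is $\mathcal C=(C,\ell)$, $C$ a family of finite sets (configurations), $\ell:\bigcup_{X\in C}X\to\mathsf{Act}$. Stable: $\emptyset\in C$; every nonempty $X\in C$ has $e\in X$ with $X\setminus\{e\}\in C$; for $X,Y,Z\in C$ with $X\cup Y\subseteq Z$, $X\cup Y\in C$ and $X\cap Y\in C$. For $X\in C$: $d\le_X e$ iff every $Y\in C$ with $Y\subseteq X$ and $e\in Y$ contains $d$; $d<_Xe$ iff $d\le_Xe$, $d\ne e$. $X\xrightarrow{e}X'$ iff $X,X'\in C$, $X\subseteq X'$, $X'\setminus X=\{e\}$; $X\xrightarrow{a}X'$ iff $X\xrightarrow{e}X'$ with $\ell(e)=a$. Standing assumption: image finiteness. $X\cong Y$ means there is a label-preserving bijection $f:X\to Y$ with $d<_Xe\iff f(d)<_Yf(e)$. WH bisimulation. $\mathcal R\subseteq C_{\mathcal C}\times C_{\mathcal D}$ with $\mathcal R(\emptyset,\emptyset)$ such that whenever $\mathcal R(X,Y)$ and $a\in\mathsf{Act}$: $X\cong Y$; if $X\xrightarrow{a}X'$ then $\exists Y'$, $Y\xrightarrow{a}Y'$, $\mathcal R(X',Y')$; symmetrically for $Y\xrightarrow{a}Y'$. EIL. Syntax $\phi::=\mathrm{tt}\mid\neg\phi\mid\phi\wedge\phi'\mid\langle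 x:a\rangle\phi\mid(x:a)\phi\mid\langle\!\langle x\rangle\!\rangle\phi$; $\langle x:a\rangle,(x:a)$ bind $x$; $\mathrm{fi}(\langle\!\langle x\rangle\!\rangle\phi)=\mathrm{fi}(\phi)\cup\{x\}$, other clauses as usual; closed = no free identifiers. Environment $\rho$ is permissible for $\phi$ and $X$ if $\mathrm{fi}(\phi)\subseteq\mathrm{dom}\rho$, $\rho(\mathrm{fi}(\phi))\subseteq X$. Semantics: $\mathrm{tt}$, $\neg$, $\wedge$ classical; $X,\rho\models\langle x:a\rangle\phi$ iff $\exists X',e$: $X\xrightarrow{e}X'$, $\ell(e)=a$, $X',\rho[x\mapsto e]\models\phi$; $X,\rho\models(x:a)\phi$ iff $\exists e\in X$, $\ell(e)=a$, $X,\rho[x\mapsto e]\models\phi$; $X,\rho\models\langle\!\langle x\rangle\!\rangle\phi$ iff $\exists X',e$: $X'\xrightarrow{e}X$, $\rho(x)=e$, $\rho$ permissible for $\phi$ and $X'$, $X',\rho\models\phi$. For closed $\phi$: $\mathcal C\models\phi$ iff $\emptyset,\emptyset\models\phi$. $\mathcal C\equiv_L\mathcal D$ iff for all closed $\phi\in L$: $\mathcal C\models\phi\iff\mathcal D\models\phi$. Abbreviation: $\langle a\rangle\phi$ stands for $\langle x:a\rangle\phi$ with $x$ not free in $\phi$. Sublogics. $\mathrm{EIL}_{ro}$: $\phi::=\mathrm{tt}\mid\neg\phi\mid\phi\wedge\phi'\mid(x:a)\phi\mid\langle\!\langle x\rangle\!\rangle\phi$. $\mathrm{EIL}_{wh}$: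 $\phi::=\mathrm{tt}\mid\neg\phi\mid\phi\wedge\phi'\mid\langle a\rangle\phi\mid\phi_{rc}$, where $\phi_{rc}$ ranges over closed formulas of $\mathrm{EIL}_{ro}$ (all formulas of $\mathrm{EIL}_{wh}$ are closed). -}

module Defs where

open import Level using (0ℓ)
open import Data.Nat using (ℕ; _≟_)
open import Data.Maybe using (Maybe; just; nothing)
open import Data.List using (List; []; _∷_; _++_; filter)
open import Data.List.Membership.Propositional using () renaming (_∈_ to _∈ₗ_)
open import Data.List.Relation.Unary.All using (All)
open import Data.Product using (Σ; ∃; ∃-syntax; _×_; _,_; proj₁)
open import Data.Sum using (_⊎_)
open import Data.Unit using (⊤)
open import Data.Empty using (⊥)
open import Data.Bool using (if_then_else_)
open import Relation.Nullary using (¬_; does; ¬?)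
open import Relation.Binary.PropositionalEquality using (_≡_; _≢_)
open import Function.Bundles using (_⇔_; _⤖_; Bijection)

-- A family C of finite sets of events is represented as an index type
-- Conf with a (proof-irrelevant) membership relation; extensionality
-- makes distinct indices denote distinct sets, so Conf really is a
-- family of sets.

record ConfStruct (Act : Set) : Set₁ where
  field
    Ev    : Set
    ℓ     : Ev → Act
    Conf  : Set
    _∈_   : Ev → Conf → Set
    ∈-irr : ∀ {e X} (p q : e ∈ X) → p ≡ q
    ext   : ∀ X Y → (∀ e → (e ∈ X → e ∈ Y) × (e ∈ Y → e ∈ X)) → X ≡ Y
    finite : ∀ X → ∃[ l ] (∀ e → (e ∈ X → e ∈ₗ l) × (e ∈ₗ l → e ∈ X))

  _⊆_ : Conf → Conf → Set
  Y ⊆ X = ∀ e → e ∈ Y → e ∈ X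

  IsEmpty : Conf → Set
  IsEmpty X = ∀ e → ¬ (e ∈ X)

  _⟶[_]_ : Conf → Ev → Conf → Set
  X ⟶[ e ] X' = ¬ (e ∈ X) × (∀ d → (d ∈ X' → d ∈ X ⊎ d ≡ e) × (d ∈ X ⊎ d ≡ e → d ∈ X'))

  _⟶⟨_⟩_ : Conf → Act → Conf → Set
  X ⟶⟨ a ⟩ X' = ∃[ e ] (X ⟶[ e ] X' × ℓ e ≡ a)

  _≤[_]_ : Ev → Conf → Ev → Set
  d ≤[ X ] e = ∀ Y → Y ⊆ X → e ∈ Y → d ∈ Y

  _<[_]_ : Ev → Conf → Ev → Set
  d <[ X ] e = d ≤[ X ] e × d ≢ e

  ⟦_⟧ : Conf → Set
  ⟦ X ⟧ = Σ Ev (λ e → e ∈ X)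

module CS = ConfStruct

record Stable {Act : Set} (𝒞 : ConfStruct Act) : Set where
  open ConfStruct 𝒞
  field
    empty : ∃[ X ] IsEmpty X
    rooted : ∀ X → (∃[ e ] e ∈ X) →
             ∃[ e ] (e ∈ X × ∃[ Y ] (∀ d → (d ∈ Y → d ∈ X × d ≢ e) × (d ∈ X × d ≢ e → d ∈ Y)))
    union : ∀ X Y Z → (∀ e → e ∈ X ⊎ e ∈ Y → e ∈ Z) →
            ∃[ U ] (∀ e → (e ∈ U → e ∈ X ⊎ e ∈ Y) × (e ∈ X ⊎ e ∈ Y → e ∈ U))
    inter : ∀ X Y Z → (∀ e → e ∈ X ⊎ e ∈ Y → e ∈ Z) →
            ∃[ V ] (∀ e → (e ∈ V → e ∈ X × e ∈ Y) × (e ∈ X × e ∈ Y → e ∈ V))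

ImageFinite : {Act : Set} → ConfStruct Act → Set
ImageFinite 𝒞 = ∀ X a → ∃[ l ] (∀ X' → CS._⟶⟨_⟩_ 𝒞 X a X' → X' ∈ₗ l)

_∣_≅_∣_ : {Act : Set} (𝒞 : ConfStruct Act) → CS.Conf 𝒞 → (𝒟 : ConfStruct Act) → CS.Conf 𝒟 → Set
𝒞 ∣ X ≅ 𝒟 ∣ Y =
  Σ (CS.⟦_⟧ 𝒞 X ⤖ CS.⟦_⟧ 𝒟 Y) λ f →
    (∀ x → CS.ℓ 𝒟 (proj₁ (Bijection.to f x)) ≡ CS.ℓ 𝒞 (proj₁ x)) ×
    (∀ x y → (CS._<[_]_ 𝒞 (proj₁ x) X (proj₁ y))
           ⇔ (CS._<[_]_ 𝒟 (proj₁ (Bijection.to f x)) Y (proj₁ (Bijection.to f y))))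

record IsWHBisim {Act : Set} (𝒞 𝒟 : ConfStruct Act) (R : CS.Conf 𝒞 → CS.Conf 𝒟 → Set) : Set where
  field
    root : ∀ X Y → CS.IsEmpty 𝒞 X → CS.IsEmpty 𝒟 Y → R X Y
    iso  : ∀ X Y → R X Y → 𝒞 ∣ X ≅ 𝒟 ∣ Y
    forth : ∀ X Y → R X Y → ∀ a X' → CS._⟶⟨_⟩_ 𝒞 X a X' →
            ∃[ Y' ] (CS._⟶⟨_⟩_ 𝒟 Y a Y' × R X' Y')
    back : ∀ X Y → R X Y → ∀ a Y' → CS._⟶⟨_⟩_ 𝒟 Y a Y' →
           ∃[ X' ] (CS._⟶⟨_⟩_ 𝒞 X a X' × R X' Y')

WHBisimilar : {Act : Set} → ConfStruct Act → ConfStruct Act → Set₁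
WHBisimilar 𝒞 𝒟 = ∃[ R ] IsWHBisim 𝒞 𝒟 R

Id : Set
Id = ℕ

data Form (Act : Set) : Set where
  tt    : Form Act
  ¬'_   : Form Act → Form Act
  _∧'_  : Form Act → Form Act → Form Act
  ⟨_∶_⟩_ : Id → Act → Form Act → Form Act
  [_∶_]_ : Id → Act → Form Act → Form Act
  ⟪_⟫_  : Id → Form Act → Form Act

remove : Id → List Id → List Id
remove x = filter (λ y → ¬? (y ≟ x))

fi : {Act : Set} → Form Act → List Id
fi tt = []
fi (¬' φ) = fi φ
fi (φ ∧' ψ) = fi φ ++ fi ψ
fi (⟨ x ∶ a ⟩ φ) = remove x (fi φ)
fi ([ x ∶ a ] φ) = remove x (fi φ)
fi (⟪ x ⟫ φ) = x ∷ fi φ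

Closed : {Act : Set} → Form Act → Set
Closed φ = fi φ ≡ []

module Semantics {Act : Set} (𝒞 : ConfStruct Act) where
  open ConfStruct 𝒞

  Env : Set
  Env = Id → Maybe Ev

  ρ∅ : Env
  ρ∅ _ = nothing

  _[_↦_] : Env → Id → Ev → Env
  (ρ [ x ↦ e ]) y = if does (y ≟ x) then just e else ρ y

  Permissible : Env → Form Act → Conf → Set
  Permissible ρ φ X = All (λ x → ∃[ e ] (ρ x ≡ just e × e ∈ X)) (fi φ)

  _,_⊨_ : Conf → Env → Form Act → Set
  X , ρ ⊨ tt = ⊤
  X , ρ ⊨ (¬' φ) = ¬ (X , ρ ⊨ φ)
  X , ρ ⊨ (φ ∧' ψ) = (X , ρ ⊨ φ) × (X , ρ ⊨ ψ)
  X , ρ ⊨ (⟨ x ∶ a ⟩ φ) = ∃[ X' ] ∃[ e ] (X ⟶[ e ] X' × ℓ e ≡ a × (X' , ρ [ x ↦ e ] ⊨ φ))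
  X , ρ ⊨ ([ x ∶ a ] φ) = ∃[ e ] (e ∈ X × ℓ e ≡ a × (X , ρ [ x ↦ e ] ⊨ φ))
  X , ρ ⊨ (⟪ x ⟫ φ) = ∃[ X' ] ∃[ e ] (X' ⟶[ e ] X × ρ x ≡ just e × Permissible ρ φ X' × (X' , ρ ⊨ φ))

  Models : Form Act → Set
  Models φ = ∃[ X ] (IsEmpty X × (X , ρ∅ ⊨ φ))

IsRo : {Act : Set} → Form Act → Set
IsRo tt = ⊤
IsRo (¬' φ) = IsRo φ
IsRo (φ ∧' ψ) = IsRo φ × IsRo ψ
IsRo (⟨ x ∶ a ⟩ φ) = ⊥
IsRo ([ x ∶ a ] φ) = IsRo φ
IsRo (⟪ x ⟫ φ) = IsRo φ

data FormWH (Act : Set) : Set where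
  tt   : FormWH Act
  ¬'_  : FormWH Act → FormWH Act
  _∧'_ : FormWH Act → FormWH Act → FormWH Act
  ⟨_⟩_ : Act → FormWH Act → FormWH Act
  rc   : (φ : Form Act) → IsRo φ → Closed φ → FormWH Act

-- embedding into EIL; ⟨a⟩φ abbreviates ⟨x:a⟩φ with x not free in φ
-- (all EIL_wh formulas are closed, so identifier 0 works)
embed : {Act : Set} → FormWH Act → Form Act
embed tt = tt
embed (¬' φ) = ¬' embed φ
embed (φ ∧' ψ) = embed φ ∧' embed ψ
embed (⟨ a ⟩ φ) = ⟨ 0 ∶ a ⟩ embed φ
embed (rc φ _ _) = φ

_≡wh_ : {Act : Set} → ConfStruct Act → ConfStruct Act → Set
𝒞 ≡wh 𝒟 = ∀ φ → Semantics.Models 𝒞 (embed φ) ⇔ Semantics.Models 𝒟 (embed φ)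

module Submission where

-- Both directions rest on the structure of stable configuration structures (StableFacts):
-- every subconfiguration is reached by removing one event at a time, causality is
-- antisymmetric, and maximal events can be removed.
--
-- Soundness is an induction on EIL_wh formulas (wh-invariant): ⟨ a ⟩ is handled by the
-- transfer conditions, and closed EIL_ro formulas are invariant under the isomorphisms
-- X ≅ Y of the bisimulation (ro-invariant), whose reverse-step case ⟪ x ⟫ restricts an
-- isomorphism along the removal of a maximal event (iso-undo).
--
-- Completeness shows that EIL_wh-equivalence of configurations is a WH bisimulation.
-- The transfer conditions follow by image finiteness: finitely many candidate successors
-- are refuted at once by a conjunction (Separation). For the isomorphism condition the
-- events of X are named one by one and matched with events of Y so that both sides keep
-- satisfying the same EIL_ro formulas over the names (Match, match-extend). A matching
-- naming all of X is an isomorphism (Match⇒EventIso): undoing named events along descents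
-- (match-undo, descend) transfers causality and leaves no unnamed events in Y.

open import Defs
open import Level using (0ℓ)
open import Axiom.ExcludedMiddle using (ExcludedMiddle)
open import Axiom.DoubleNegationElimination using (em⇒dne)
open import Function.Bundles using (_⇔_; _⤖_; Bijection; Equivalence; mk⇔)
open import Function.Construct.Identity using (⤖-id; ⇔-id)
open import Function.Construct.Symmetry using (⇔-sym)
open import Function.Related.TypeIsomorphisms using (¬-cong-⇔)
open import Data.Nat using (suc; _<_; _≟_; _≡ᵇ_; s≤s⁻¹)
open import Data.Nat.Properties using (<-≤-trans; ≤-refl; ≡⇒≡ᵇ; ≡ᵇ⇒≡; <⇒≢; m<n⇒m<1+n; n<1+n; m<1+n⇒m<n∨m≡n)
open import Data.Bool using (true; false)
open import Data.Maybe using (just)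
open import Data.Maybe.Properties using (just-injective)
open import Data.List using (List; []; _∷_; length; filter)
open import Data.List.Properties using (filter-notAll)
open import Data.List.Relation.Unary.Any using (here; there) renaming (map to any-map)
open import Data.List.Relation.Unary.All as All using (All; _∷_; [])
open import Data.List.Membership.Propositional using () renaming (_∈_ to _∈ₗ_)
open import Data.List.Membership.Propositional.Properties using (∈-filter⁺; ∈-filter⁻; ∈-++⁺ˡ; ∈-++⁺ʳ; ∈-++⁻)
open import Data.Product using (Σ; ∃-syntax; _×_; _,_; proj₁; proj₂)
open import Data.Product.Function.NonDependent.Propositional using (_×-⇔_)
open import Data.Sum using (_⊎_; inj₁; inj₂; [_,_]; swap)
open import Data.Empty using (⊥-elim)
open import Data.Unit using (⊤; tt)
open import Relation.Nullary using (¬_; Dec; yes; no; ¬?)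
open import Relation.Binary.PropositionalEquality using (_≡_; _≢_; refl; sym; trans; subst; subst₂; cong)

module Steps {Act : Set} (𝒞 : ConfStruct Act) where
  open ConfStruct 𝒞

  step-⊆ : ∀ {X e X'} → X ⟶[ e ] X' → X ⊆ X'
  step-⊆ (_ , spec) d d∈X = proj₂ (spec d) (inj₁ d∈X)

  step-new : ∀ {X e X'} → X ⟶[ e ] X' → e ∈ X'
  step-new (_ , spec) = proj₂ (spec _) (inj₂ refl)

  step-old : ∀ {X' g X h} → X' ⟶[ g ] X → h ∈ X → h ≢ g → h ∈ X'
  step-old (_ , spec) h∈X h≢g with proj₁ (spec _) h∈X
  ... | inj₁ h∈X' = h∈X'
  ... | inj₂ h≡g = ⊥-elim (h≢g h≡g)

  step-source-unique : ∀ {X X' e Y} → X ⟶[ e ] Y → X' ⟶[ e ] Y → X ≡ X'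
  step-source-unique {X} {X'} s s' =
    ext X X' λ d → (λ d∈X → step-old s' (step-⊆ s d d∈X) (λ { refl → proj₁ s d∈X })) ,
                   (λ d∈X' → step-old s (step-⊆ s' d d∈X') (λ { refl → proj₁ s' d∈X' }))

  empty-unique : ∀ {X Y} → IsEmpty X → IsEmpty Y → X ≡ Y
  empty-unique {X} {Y} X-empty Y-empty =
    ext X Y λ d → (λ d∈X → ⊥-elim (X-empty d d∈X)) , (λ d∈Y → ⊥-elim (Y-empty d d∈Y))

  event-≡ : ∀ {X} {u v : ⟦ X ⟧} → proj₁ u ≡ proj₁ v → u ≡ v
  event-≡ {u = e , p} {.e , q} refl = cong (e ,_) (∈-irr p q)

  ≤-reflexive : ∀ {X d e} → d ≡ e → d ≤[ X ] e
  ≤-reflexive refl _ _ d∈Y = d∈Y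

  ≤-restrict : ∀ {X X' d g} → X' ⊆ X → d ≤[ X ] g → d ≤[ X' ] g
  ≤-restrict X'⊆X d≤g Y Y⊆X' g∈Y = d≤g Y (λ h h∈Y → X'⊆X h (Y⊆X' h h∈Y)) g∈Y

  Maximal : Conf → Ev → Set
  Maximal X e = ∀ g → g ∈ X → ¬ (e <[ X ] g)

  step-maximal : ∀ {X' g X} → X' ⟶[ g ] X → Maximal X g
  step-maximal s h h∈X (g≤h , g≢h) = proj₁ s (g≤h _ (step-⊆ s) (step-old s h∈X (λ h≡g → g≢h (sym h≡g))))

  data Descent : Conf → Conf → Set where
    stop : ∀ {X} → Descent X X
    _◅_  : ∀ {X X' Z e} → X' ⟶[ e ] X → Descent X' Z → Descent X Z

  descent-⊆ : ∀ {X Z} → Descent X Z → Z ⊆ X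
  descent-⊆ stop d d∈Z = d∈Z
  descent-⊆ (s ◅ r) d d∈Z = step-⊆ s d (descent-⊆ r d d∈Z)

  IsUnion : Conf → Conf → Conf → Set
  IsUnion U A B = ∀ d → (d ∈ U → d ∈ A ⊎ d ∈ B) × (d ∈ A ⊎ d ∈ B → d ∈ U)

  union-unique : ∀ {U U' A B} → IsUnion U A B → IsUnion U' A B → U ≡ U'
  union-unique {U} {U'} u u' = ext U U' λ d → (λ x → proj₂ (u' d) (proj₁ (u d) x)) ,
                                             (λ x → proj₂ (u d) (proj₁ (u' d) x))

  union-absorb : ∀ {A' g A Z U} → A' ⟶[ g ] A → g ∈ Z → IsUnion U A' Z → IsUnion U A Z
  union-absorb {A'} {g} {A} {Z} s g∈Z u d =
    (λ d∈U → [ (λ d∈A' → inj₁ (step-⊆ s d d∈A')) , inj₂ ] (proj₁ (u d) d∈U)) ,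
    [ (λ d∈A → proj₂ (u d) (absorb d∈A)) , (λ d∈Z → proj₂ (u d) (inj₂ d∈Z)) ]
    where
    absorb : ∀ {d} → d ∈ A → d ∈ A' ⊎ d ∈ Z
    absorb d∈A with proj₁ (proj₂ s _) d∈A
    ... | inj₁ d∈A' = inj₁ d∈A'
    ... | inj₂ refl = inj₂ g∈Z

  union-step : ∀ {A' g A Z U' U} → A' ⟶[ g ] A → ¬ g ∈ Z → IsUnion U' A' Z → IsUnion U A Z → U' ⟶[ g ] U
  union-step {A'} {g} {A} {Z} {U'} s g∉Z u' u =
    (λ g∈U' → [ proj₁ s , g∉Z ] (proj₁ (u' _) g∈U')) ,
    λ d → (λ d∈U → [ fromA , (λ d∈Z → inj₁ (proj₂ (u' d) (inj₂ d∈Z))) ] (proj₁ (u d) d∈U)) ,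
          [ (λ d∈U' → proj₂ (u d) ([ (λ d∈A' → inj₁ (step-⊆ s d d∈A')) , inj₂ ] (proj₁ (u' d) d∈U'))) ,
            (λ { refl → proj₂ (u d) (inj₁ (step-new s)) }) ]
    where
    fromA : ∀ {d} → d ∈ A → d ∈ U' ⊎ d ≡ g
    fromA d∈A with proj₁ (proj₂ s _) d∈A
    ... | inj₁ d∈A' = inj₁ (proj₂ (u' _) (inj₁ d∈A'))
    ... | inj₂ d≡g = inj₂ d≡g

module Classical (em : ExcludedMiddle 0ℓ) where

  dne : {P : Set} → ¬ ¬ P → P
  dne = em⇒dne em

  module Causality {Act : Set} (𝒞 : ConfStruct Act) where
    open ConfStruct 𝒞

    ≰-witness : ∀ {X d e} → ¬ (d ≤[ X ] e) → ∃[ Z ] (Z ⊆ X × e ∈ Z × ¬ d ∈ Z)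
    ≰-witness d≰e = dne λ none → d≰e λ Y Y⊆X e∈Y → dne λ d∉Y → none (Y , Y⊆X , e∈Y , d∉Y)

    ≤-split : ∀ {X d e} → d ≤[ X ] e → d ≡ e ⊎ d <[ X ] e
    ≤-split {d = d} {e} d≤e with em {d ≡ e}
    ... | yes d≡e = inj₁ d≡e
    ... | no d≢e = inj₂ (d≤e , d≢e)

module StableFacts (em : ExcludedMiddle 0ℓ) {Act : Set} (𝒞 : ConfStruct Act) (st : Stable 𝒞) where
  open ConfStruct 𝒞
  open Stable st
  open Steps 𝒞
  open Classical em
  open Causality 𝒞

  descent-∪ : ∀ {A B X Z U W} → Descent A B → A ⊆ X → Z ⊆ X → IsUnion U A Z → IsUnion W B Z → Descent U W
  descent-∪ stop _ _ u w = subst (Descent _) (union-unique u w) stop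
  descent-∪ {X = X} {Z} {U} {W} (_◅_ {X' = A'} {e = g} s r) A⊆X Z⊆X u w =
    lift (union A' Z X (λ d → [ A'⊆X d , Z⊆X d ])) (em {g ∈ Z})
    where
    A'⊆X : A' ⊆ X
    A'⊆X d d∈A' = A⊆X d (step-⊆ s d d∈A')
    lift : ∃[ U' ] IsUnion U' A' Z → Dec (g ∈ Z) → Descent U W
    lift (U' , u') (yes g∈Z) = subst (λ V → Descent V W) (union-unique (union-absorb s g∈Z u') u) (descent-∪ r A'⊆X Z⊆X u' w)
    lift (U' , u') (no g∉Z) = union-step s g∉Z u' u ◅ descent-∪ r A'⊆X Z⊆X u' w

  rooted-step : ∀ X → ∃[ e ] e ∈ X → ∃[ g ] ∃[ X₁ ] (X₁ ⟶[ g ] X)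
  rooted-step X nonempty with rooted X nonempty
  ... | g , g∈X , X₁ , spec =
    g , X₁ , (λ g∈X₁ → proj₂ (proj₁ (spec g) g∈X₁) refl) ,
    λ d → split d , [ (λ d∈X₁ → proj₁ (proj₁ (spec d) d∈X₁)) , (λ { refl → g∈X }) ]
    where
    split : ∀ d → d ∈ X → d ∈ X₁ ⊎ d ≡ g
    split d d∈X with em {d ≡ g}
    ... | yes d≡g = inj₂ d≡g
    ... | no d≢g = inj₁ (proj₂ (spec d) (d∈X , d≢g))

  Covers : List Ev → Conf → Set
  Covers l X = ∀ e → e ∈ X → e ∈ₗ l

  without : Ev → List Ev → List Ev
  without g = filter (λ d → ¬? (em {d ≡ g}))

  cover-step : ∀ {l X₁ g X} → Covers l X → X₁ ⟶[ g ] X → Covers (without g l) X₁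
  cover-step cov s d d∈X₁ = ∈-filter⁺ _ (cov d (step-⊆ s d d∈X₁)) (λ { refl → proj₁ s d∈X₁ })

  without-shorter : ∀ {g l} → g ∈ₗ l → length (without g l) < length l
  without-shorter g∈l = filter-notAll _ _ (any-map (λ { refl ¬g≡g → ¬g≡g refl }) g∈l)

  -- if every subconfiguration of X₁ is reached from X₁ by a descent and X₁ ⟶[ g ] X,
  -- then so is every subconfiguration Z of X: if g ∉ Z descend to X₁ first; otherwise
  -- descend from X₁ to Z ∩ X₁ and add Z back, as X₁ ∪ Z = X and (Z ∩ X₁) ∪ Z = Z
  descent-extend : ∀ {X₁ g X} → X₁ ⟶[ g ] X → (∀ Z₁ → Z₁ ⊆ X₁ → Descent X₁ Z₁) →
                   ∀ Z → Z ⊆ X → Descent X Z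
  descent-extend {X₁} {g} {X} s below Z Z⊆X with em {g ∈ Z}
  ... | no g∉Z = s ◅ below Z (λ d d∈Z → step-old s (Z⊆X d d∈Z) (λ { refl → g∉Z d∈Z }))
  ... | yes g∈Z with inter Z X₁ X (λ d → [ Z⊆X d , step-⊆ s d ])
  ... | Z₁ , z₁ = descent-∪ (below Z₁ (λ d d∈Z₁ → proj₂ (proj₁ (z₁ d) d∈Z₁))) (step-⊆ s) Z⊆X X∪ Z∪
    where
    X∪ : IsUnion X X₁ Z
    X∪ d = (λ d∈X → [ inj₁ , (λ { refl → inj₂ g∈Z }) ] (proj₁ (proj₂ s d) d∈X)) , [ step-⊆ s d , Z⊆X d ]
    Z∪ : IsUnion Z Z₁ Z
    Z∪ d = inj₂ , [ (λ d∈Z₁ → proj₁ (proj₁ (z₁ d) d∈Z₁)) , (λ d∈Z → d∈Z) ]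

  -- induction on the length n of a list covering X
  descent-bounded : ∀ n l X → length l < n → Covers l X → ∀ Z → Z ⊆ X → Descent X Z
  descent-bounded (suc n) l X len cov Z Z⊆X with em {∃[ g ] g ∈ X}
  ... | no empty-X = subst (Descent X) (ext X Z λ d → (λ d∈X → ⊥-elim (empty-X (d , d∈X))) , Z⊆X d) stop
  ... | yes nonempty with rooted-step X nonempty
  ... | g , X₁ , s = descent-extend s (descent-bounded n _ X₁ len₁ (cover-step cov s)) Z Z⊆X
    where
    len₁ : length (without g l) < n
    len₁ = <-≤-trans (without-shorter (cov g (step-new s))) (s≤s⁻¹ len)

  descent-exists : ∀ X Z → Z ⊆ X → Descent X Z
  descent-exists X Z Z⊆X =
    let (l , spec) = finite X in descent-bounded _ l X ≤-refl (λ e e∈X → proj₁ (spec e) e∈X) Z Z⊆X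

  -- causality in a subconfiguration X' persists in X (intersect the test configuration with X')
  ≤-extend : ∀ {X X' d g} → X' ⊆ X → g ∈ X' → d ≤[ X' ] g → d ≤[ X ] g
  ≤-extend {X} {X'} {d} {g} X'⊆X g∈X' d≤g Y Y⊆X g∈Y
    with inter Y X' X (λ h → [ Y⊆X h , X'⊆X h ])
  ... | W , w = proj₁ (proj₁ (w d) (d≤g W (λ h h∈W → proj₂ (proj₁ (w h) h∈W)) (proj₂ (w g) (g∈Y , g∈X'))))

  -- along a descent from X to Z, two distinct events of X outside Z are separated
  -- by the configuration just before the first of them is removed
  descent-separates : ∀ {X Z d e} → Descent X Z → d ∈ X → e ∈ X → d ≢ e → ¬ d ∈ Z → ¬ e ∈ Z →
                      ∃[ W ] (W ⊆ X × ((d ∈ W × ¬ e ∈ W) ⊎ (e ∈ W × ¬ d ∈ W)))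
  descent-separates stop d∈X _ _ d∉Z _ = ⊥-elim (d∉Z d∈X)
  descent-separates {d = d} {e} (_◅_ {X' = X'} {e = g} s r) d∈X e∈X d≢e d∉Z e∉Z
    with em {d ≡ g} | em {e ≡ g}
  ... | yes refl | _ = X' , step-⊆ s , inj₂ (step-old s e∈X (λ e≡d → d≢e (sym e≡d)) , proj₁ s)
  ... | no _ | yes refl = X' , step-⊆ s , inj₁ (step-old s d∈X d≢e , proj₁ s)
  ... | no d≢g | no e≢g with descent-separates r (step-old s d∈X d≢g) (step-old s e∈X e≢g) d≢e d∉Z e∉Z
  ... | W , W⊆X' , separated = W , (λ h h∈W → step-⊆ s h (W⊆X' h h∈W)) , separated

  -- causality is antisymmetric: separate d and e along a descent from X to the empty configuration
  ≤-antisym : ∀ {X d e} → d ∈ X → e ∈ X → d ≤[ X ] e → e ≤[ X ] d → d ≡ e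
  ≤-antisym {X} d∈X e∈X d≤e e≤d = dne λ d≢e →
    let (E , E-empty) = empty
        to-empty = descent-exists X E (λ h h∈E → ⊥-elim (E-empty h h∈E))
        (W , W⊆X , separated) = descent-separates to-empty d∈X e∈X d≢e (E-empty _) (E-empty _)
    in [ (λ (d∈W , e∉W) → e∉W (e≤d W W⊆X d∈W)) , (λ (e∈W , d∉W) → d∉W (d≤e W W⊆X e∈W)) ] separated

  -- for a maximal e ∈ X, the union of witnesses of ¬ e ≤ d over the events d of a list
  -- is a subconfiguration of X avoiding e and containing all those d
  avoiding : ∀ {X e} → Maximal X e → (l : List Ev) →
             ∃[ U ] (U ⊆ X × ¬ e ∈ U × (∀ d → d ∈ₗ l → d ∈ X → d ≢ e → d ∈ U))
  avoiding mx [] = let (E , E-empty) = empty in E , (λ h h∈E → ⊥-elim (E-empty h h∈E)) , E-empty _ , λ _ ()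
  avoiding {X} {e} mx (d ∷ l) with avoiding mx l | em {d ∈ X × d ≢ e}
  ... | U , U⊆X , e∉U , has | no ¬candidate =
    U , U⊆X , e∉U , λ { _ (here refl) d∈X d≢e → ⊥-elim (¬candidate (d∈X , d≢e)) ; d' (there m) → has d' m }
  ... | U , U⊆X , e∉U , has | yes (d∈X , d≢e)
    with ≰-witness (λ e≤d → mx d d∈X (e≤d , λ e≡d → d≢e (sym e≡d)))
  ... | Y , Y⊆X , d∈Y , e∉Y with union U Y X (λ h → [ U⊆X h , Y⊆X h ])
  ... | U' , u' =
    U' , (λ h h∈U' → [ U⊆X h , Y⊆X h ] (proj₁ (u' h) h∈U')) , (λ e∈U' → [ e∉U , e∉Y ] (proj₁ (u' e) e∈U')) ,
    λ { _ (here refl) _ _ → proj₂ (u' d) (inj₂ d∈Y)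
      ; d' (there m) d'∈X d'≢e → proj₂ (u' d') (inj₁ (has d' m d'∈X d'≢e)) }

  maximal-removable : ∀ {X e} → e ∈ X → Maximal X e → ∃[ X' ] (X' ⟶[ e ] X)
  maximal-removable {X} {e} e∈X mx with finite X
  ... | l , spec with avoiding mx l
  ... | U , U⊆X , e∉U , has = U , e∉U , λ d → split d , [ U⊆X d , (λ { refl → e∈X }) ]
    where
    split : ∀ d → d ∈ X → d ∈ U ⊎ d ≡ e
    split d d∈X with em {d ≡ e}
    ... | yes d≡e = inj₂ d≡e
    ... | no d≢e = inj₁ (has d (proj₁ (spec d) d∈X) d∈X d≢e)

module Updates {Act : Set} (𝒞 : ConfStruct Act) where
  open Semantics 𝒞

  -- the update tests identifiers with the boolean equality underlying _≟_
  update-same : ∀ ρ x e → (ρ [ x ↦ e ]) x ≡ just e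
  update-same ρ x e with x ≡ᵇ x | ≡⇒≡ᵇ x x refl
  ... | true | _ = refl

  update-other : ∀ ρ x e {y} → y ≢ x → (ρ [ x ↦ e ]) y ≡ ρ y
  update-other ρ x e {y} y≢x with y ≡ᵇ x | ≡ᵇ⇒≡ y x
  ... | true | y≡x = ⊥-elim (y≢x (y≡x tt))
  ... | false | _ = refl

-- A relational presentation of X ≅ Y: F is a label-preserving bijection between the
-- events of X and of Y that preserves and reflects causality
record EventIso {Act : Set} (𝒞 𝒟 : ConfStruct Act) (X : CS.Conf 𝒞) (Y : CS.Conf 𝒟)
                (F : CS.Ev 𝒞 → CS.Ev 𝒟 → Set) : Set where
  field
    domain   : ∀ {e e'} → F e e' → CS._∈_ 𝒞 e X × CS._∈_ 𝒟 e' Y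
    total    : ∀ e → CS._∈_ 𝒞 e X → ∃[ e' ] F e e'
    onto     : ∀ e' → CS._∈_ 𝒟 e' Y → ∃[ e ] F e e'
    function : ∀ {e e' e''} → F e e' → F e e'' → e' ≡ e''
    injective : ∀ {e g e'} → F e e' → F g e' → e ≡ g
    labels   : ∀ {e e'} → F e e' → CS.ℓ 𝒟 e' ≡ CS.ℓ 𝒞 e
    order    : ∀ {e e' g g'} → F e e' → F g g' → CS._≤[_]_ 𝒞 e X g ⇔ CS._≤[_]_ 𝒟 e' Y g'

EventIso-sym : ∀ {Act} {𝒞 𝒟 : ConfStruct Act} {X Y F} → EventIso 𝒞 𝒟 X Y F → EventIso 𝒟 𝒞 Y X (λ e' e → F e e')
EventIso-sym I = record
  { domain = λ f → proj₂ (domain f) , proj₁ (domain f) ; total = onto ; onto = total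
  ; function = injective ; injective = function
  ; labels = λ f → sym (labels f) ; order = λ f g → ⇔-sym (order f g) }
  where open EventIso I

module Isomorphisms (em : ExcludedMiddle 0ℓ) {Act : Set} (𝒞 𝒟 : ConfStruct Act) where
  open ConfStruct
  private
    module C = Steps 𝒞
    module D = Steps 𝒟
    module CC = Classical.Causality em 𝒞
    module DC = Classical.Causality em 𝒟

  -- f relates each event of X to its image; f preserves ≤ as it preserves < and is injective
  ≅⇒EventIso : ∀ X Y → 𝒞 ∣ X ≅ 𝒟 ∣ Y → ∃[ F ] EventIso 𝒞 𝒟 X Y F
  ≅⇒EventIso X Y (f , same-label , same-order) = F , record
    { domain = λ { {e} (p , refl) → p , proj₂ (to (e , p)) }
    ; total = λ e p → _ , p , refl
    ; onto = λ e' q → let (u , hit) = surjective (e' , q) in proj₁ u , proj₂ u , cong proj₁ (hit refl)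
    ; function = λ { {e} (p , refl) (p' , refl) → cong (λ r → proj₁ (to (e , r))) (∈-irr 𝒞 p p') }
    ; injective = λ { (p , refl) (q , eq) → cong proj₁ (injective (D.event-≡ (sym eq))) }
    ; labels = λ { {e} (p , refl) → same-label (e , p) }
    ; order = λ { (p , refl) (q , refl) → mk⇔ (to-≤ _ _) (from-≤ _ _) }
    }
    where
    open Bijection f using (to; injective; surjective)
    F : Ev 𝒞 → Ev 𝒟 → Set
    F e e' = Σ (_∈_ 𝒞 e X) λ p → proj₁ (to (e , p)) ≡ e'
    to-≤ : ∀ u v → _≤[_]_ 𝒞 (proj₁ u) X (proj₁ v) → _≤[_]_ 𝒟 (proj₁ (to u)) Y (proj₁ (to v))
    to-≤ u v u≤v = [ (λ u≡v → D.≤-reflexive (cong (λ w → proj₁ (to w)) (C.event-≡ u≡v))) ,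
                     (λ u<v → proj₁ (Equivalence.to (same-order u v) u<v)) ] (CC.≤-split u≤v)
    from-≤ : ∀ u v → _≤[_]_ 𝒟 (proj₁ (to u)) Y (proj₁ (to v)) → _≤[_]_ 𝒞 (proj₁ u) X (proj₁ v)
    from-≤ u v fu≤fv = [ (λ fu≡fv → C.≤-reflexive (cong proj₁ (injective (D.event-≡ fu≡fv)))) ,
                         (λ fu<fv → proj₁ (Equivalence.from (same-order u v) fu<fv)) ] (DC.≤-split fu≤fv)

  EventIso⇒≅ : ∀ {X Y F} → EventIso 𝒞 𝒟 X Y F → 𝒞 ∣ X ≅ 𝒟 ∣ Y
  EventIso⇒≅ {X} {Y} {F} I = bijection , (λ u → labels (image-rel u)) , λ u v → mk⇔
    (λ (u≤v , u≢v) → Equivalence.to (order (image-rel u) (image-rel v)) u≤v ,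
                     λ fu≡fv → u≢v (injective (image-rel u) (subst (F _) (sym fu≡fv) (image-rel v))))
    (λ (fu≤fv , fu≢fv) → Equivalence.from (order (image-rel u) (image-rel v)) fu≤fv ,
                         λ { refl → fu≢fv (function (image-rel u) (image-rel v)) })
    where
    open EventIso I
    image : ⟦_⟧ 𝒞 X → Ev 𝒟
    image (e , p) = proj₁ (total e p)
    image-rel : ∀ u → F (proj₁ u) (image u)
    image-rel (e , p) = proj₂ (total e p)
    to : ⟦_⟧ 𝒞 X → ⟦_⟧ 𝒟 Y
    to u = image u , proj₂ (domain (image-rel u))
    bijection : ⟦_⟧ 𝒞 X ⤖ ⟦_⟧ 𝒟 Y
    bijection = record
      { to = to
      ; cong = cong to
      ; bijective =
        (λ {u} {v} fu≡fv → C.event-≡ (injective (image-rel u) (subst (F _) (sym (cong proj₁ fu≡fv)) (image-rel v)))) ,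
        (λ (e' , q) → let (e , f) = onto e' q in (e , proj₁ (domain f)) ,
                      λ { refl → D.event-≡ (function (image-rel (e , _)) f) })
      }

closed-no-free : ∀ {Act} (φ : Form Act) → Closed φ → ∀ {y} → ¬ y ∈ₗ fi φ
closed-no-free φ closed m with subst (_ ∈ₗ_) closed m
... | ()

Sat : {Act : Set} (𝒞 : ConfStruct Act) → CS.Conf 𝒞 → Semantics.Env 𝒞 → Form Act → Set
Sat 𝒞 = Semantics._,_⊨_ 𝒞

Corresponding : ∀ {Act} (𝒞 𝒟 : ConfStruct Act) (F : CS.Ev 𝒞 → CS.Ev 𝒟 → Set) →
                Semantics.Env 𝒞 → Semantics.Env 𝒟 → (Id → Set) → Set
Corresponding 𝒞 𝒟 F ρC ρD P = ∀ y → P y → ∃[ e ] ∃[ e' ] (ρC y ≡ just e × ρD y ≡ just e' × F e e')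

corresponding-update : ∀ {Act} {𝒞 𝒟 : ConfStruct Act} {F ρC ρD P} x {e e'} → F e e' →
                       Corresponding 𝒞 𝒟 F ρC ρD P →
                       Corresponding 𝒞 𝒟 F (Semantics._[_↦_] 𝒞 ρC x e) (Semantics._[_↦_] 𝒟 ρD x e')
                                     (λ y → y ≡ x ⊎ P y)
corresponding-update {𝒞 = 𝒞} {𝒟} {ρC = ρC} {ρD} x {e} {e'} f corr y y∈P with y ≟ x
... | yes refl = e , e' , Updates.update-same 𝒞 ρC y e , Updates.update-same 𝒟 ρD y e' , f
... | no y≢x with y∈P
...   | inj₁ y≡x = ⊥-elim (y≢x y≡x)
...   | inj₂ Py with corr y Py
...     | v , v' , ρCy , ρDy , fv =
  v , v' , trans (Updates.update-other 𝒞 ρC x e y≢x) ρCy , trans (Updates.update-other 𝒟 ρD x e' y≢x) ρDy , fv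

free-in-body : ∀ {x y} l → y ∈ₗ l → y ≡ x ⊎ y ∈ₗ remove x l
free-in-body {x} {y} l y∈l with y ≟ x
... | yes y≡x = inj₁ y≡x
... | no y≢x = inj₂ (∈-filter⁺ (λ z → ¬? (z ≟ x)) y∈l y≢x)

Within : ∀ {Act} (𝒞 𝒟 : ConfStruct Act) → CS.Conf 𝒞 → (CS.Ev 𝒞 → CS.Ev 𝒟 → Set) → CS.Ev 𝒞 → CS.Ev 𝒟 → Set
Within 𝒞 𝒟 X' F a b = F a b × CS._∈_ 𝒞 a X'

module _ (em : ExcludedMiddle 0ℓ) {Act : Set} {𝒞 𝒟 : ConfStruct Act} (sC : Stable 𝒞) (sD : Stable 𝒟) where
  open ConfStruct
  open EventIso
  private
    module C = StableFacts em 𝒞 sC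
    module D = StableFacts em 𝒟 sD
    module C₀ = Steps 𝒞
    module D₀ = Steps 𝒟

  image-maximal : ∀ {X Y F X' g g'} → EventIso 𝒞 𝒟 X Y F → _⟶[_]_ 𝒞 X' g X → F g g' → D₀.Maximal Y g'
  image-maximal I s f h' h'∈Y (g'≤h' , g'≢h') with onto I h' h'∈Y
  ... | h , fh = C₀.step-maximal s h (proj₁ (domain I fh))
                   (Equivalence.from (order I f fh) g'≤h' , λ { refl → g'≢h' (function I f fh) })

  -- undoing an event on one side of an isomorphism can be matched by undoing its image,
  -- which is removable as it is maximal; the isomorphism restricts to the results
  iso-undo : ∀ {X Y F X' g g'} → EventIso 𝒞 𝒟 X Y F → _⟶[_]_ 𝒞 X' g X → F g g' →
             ∃[ Y' ] (_⟶[_]_ 𝒟 Y' g' Y × EventIso 𝒞 𝒟 X' Y' (Within 𝒞 𝒟 X' F))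
  iso-undo {X} {Y} {F} {X'} {g} {g'} I s f with D.maximal-removable (proj₂ (domain I f)) (image-maximal I s f)
  ... | Y' , s' = Y' , s' , record
    { domain = λ (fab , a∈X') → a∈X' , in-Y' fab a∈X'
    ; total = λ a a∈X' → let (b , fab) = total I a (C₀.step-⊆ s a a∈X') in b , fab , a∈X'
    ; onto = λ b b∈Y' → let (a , fab) = onto I b (D₀.step-⊆ s' b b∈Y') in a , fab , in-X' fab b∈Y'
    ; function = λ (p , _) (q , _) → function I p q
    ; injective = λ (p , _) (q , _) → injective I p q
    ; labels = λ (p , _) → labels I p
    ; order = λ (p , _) (q , c∈X') → mk⇔
        (λ a≤c → D₀.≤-restrict (D₀.step-⊆ s')
                   (Equivalence.to (order I p q) (C.≤-extend (C₀.step-⊆ s) c∈X' a≤c)))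
        (λ b≤d → C₀.≤-restrict (C₀.step-⊆ s)
                   (Equivalence.from (order I p q) (D.≤-extend (D₀.step-⊆ s') (in-Y' q c∈X') b≤d)))
    }
    where
    in-Y' : ∀ {a b} → F a b → _∈_ 𝒞 a X' → _∈_ 𝒟 b Y'
    in-Y' fab a∈X' = D₀.step-old s' (proj₂ (domain I fab))
                       (λ { refl → proj₁ s (subst (λ z → _∈_ 𝒞 z X') (injective I fab f) a∈X') })
    in-X' : ∀ {a b} → F a b → _∈_ 𝒟 b Y' → _∈_ 𝒞 a X'
    in-X' fab b∈Y' = C₀.step-old s (proj₁ (domain I fab))
                       (λ { refl → proj₁ s' (subst (λ z → _∈_ 𝒟 z Y') (function I fab f) b∈Y') })

module _ (em : ExcludedMiddle 0ℓ) where
  open EventIso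

  ro-preserved : ∀ {Act} (𝒞 𝒟 : ConfStruct Act) → Stable 𝒞 → Stable 𝒟 → ∀ φ → IsRo φ →
                 ∀ {X Y F} → EventIso 𝒞 𝒟 X Y F → ∀ {ρC ρD} → Corresponding 𝒞 𝒟 F ρC ρD (_∈ₗ fi φ) →
                 Sat 𝒞 X ρC φ → Sat 𝒟 Y ρD φ
  ro-preserved 𝒞 𝒟 sC sD tt _ _ _ _ = tt
  ro-preserved 𝒞 𝒟 sC sD (¬' φ) ro I corr ¬sat sat =
    ¬sat (ro-preserved 𝒟 𝒞 sD sC φ ro (EventIso-sym I)
            (λ y m → let (e , e' , ρCy , ρDy , f) = corr y m in e' , e , ρDy , ρCy , f) sat)
  ro-preserved 𝒞 𝒟 sC sD (φ ∧' ψ) (roφ , roψ) I corr (satφ , satψ) =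
    ro-preserved 𝒞 𝒟 sC sD φ roφ I (λ y m → corr y (∈-++⁺ˡ m)) satφ ,
    ro-preserved 𝒞 𝒟 sC sD ψ roψ I (λ y m → corr y (∈-++⁺ʳ (fi φ) m)) satψ
  ro-preserved 𝒞 𝒟 sC sD ([ x ∶ a ] φ) ro I corr (e , e∈X , ℓe , sat) with total I e e∈X
  ... | e' , f = e' , proj₂ (domain I f) , trans (labels I f) ℓe ,
                 ro-preserved 𝒞 𝒟 sC sD φ ro I
                   (λ y m → corresponding-update {𝒞 = 𝒞} {𝒟} x f corr y (free-in-body (fi φ) m)) sat
  ro-preserved 𝒞 𝒟 sC sD (⟪ x ⟫ φ) ro {F = F} I {ρC} {ρD} corr (X' , g , s , ρCx≡g , perm , sat)
    with corr x (here refl)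
  ... | e , e' , ρCx , ρDx , f with trans (sym ρCx≡g) ρCx
  ... | refl with iso-undo em sC sD I s f
  ... | Y' , s' , I' = Y' , e' , s' , ρDx , perm' , ro-preserved 𝒞 𝒟 sC sD φ ro I' corr' sat
    where
    -- permissibility of ρC for φ and X' confines the correspondence to X'
    corr' : Corresponding 𝒞 𝒟 (Within 𝒞 𝒟 X' F) ρC ρD (_∈ₗ fi φ)
    corr' y m with corr y (there m) | All.lookup perm m
    ... | v , v' , ρCy , ρDy , fv | w , ρCy' , w∈X' =
      v , v' , ρCy , ρDy , fv , subst (λ z → CS._∈_ 𝒞 z X') (just-injective (trans (sym ρCy') ρCy)) w∈X'
    perm' : Semantics.Permissible 𝒟 ρD φ Y'
    perm' = All.tabulate λ m → let (_ , v' , _ , ρDy , fv) = corr' _ m in v' , ρDy , proj₂ (domain I' fv)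

  ro-invariant : ∀ {Act} (𝒞 𝒟 : ConfStruct Act) → Stable 𝒞 → Stable 𝒟 → ∀ φ → IsRo φ → Closed φ →
                 ∀ {X Y F} → EventIso 𝒞 𝒟 X Y F → ∀ ρC ρD → Sat 𝒞 X ρC φ ⇔ Sat 𝒟 Y ρD φ
  ro-invariant 𝒞 𝒟 sC sD φ ro closed I ρC ρD = mk⇔
    (ro-preserved 𝒞 𝒟 sC sD φ ro I (λ y m → ⊥-elim (closed-no-free φ closed m)))
    (ro-preserved 𝒟 𝒞 sD sC φ ro (EventIso-sym I) (λ y m → ⊥-elim (closed-no-free φ closed m)))

  wh-invariant : ∀ {Act} {𝒞 𝒟 : ConfStruct Act} → Stable 𝒞 → Stable 𝒟 → ∀ {R} → IsWHBisim 𝒞 𝒟 R →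
                 ∀ φ {X Y} → R X Y → ∀ ρC ρD → Sat 𝒞 X ρC (embed φ) ⇔ Sat 𝒟 Y ρD (embed φ)
  wh-invariant sC sD B tt r ρC ρD = ⇔-id _
  wh-invariant sC sD B (¬' φ) r ρC ρD = ¬-cong-⇔ (wh-invariant sC sD B φ r ρC ρD)
  wh-invariant sC sD B (φ ∧' ψ) r ρC ρD = wh-invariant sC sD B φ r ρC ρD ×-⇔ wh-invariant sC sD B ψ r ρC ρD
  wh-invariant sC sD B (⟨ a ⟩ φ) {X} {Y} r ρC ρD = mk⇔
    (λ (X' , e , s , ℓe , sat) → let (Y' , (e' , s' , ℓe') , r') = IsWHBisim.forth B X Y r a X' (e , s , ℓe)
                                 in Y' , e' , s' , ℓe' , Equivalence.to (wh-invariant sC sD B φ r' _ _) sat)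
    (λ (Y' , e' , s' , ℓe' , sat) → let (X' , (e , s , ℓe) , r') = IsWHBisim.back B X Y r a Y' (e' , s' , ℓe')
                                    in X' , e , s , ℓe , Equivalence.from (wh-invariant sC sD B φ r' _ _) sat)
  wh-invariant sC sD B (rc φ ro closed) {X} {Y} r ρC ρD =
    ro-invariant _ _ sC sD φ ro closed (proj₂ (Isomorphisms.≅⇒EventIso em _ _ X Y (IsWHBisim.iso B X Y r))) ρC ρD

  identity-bisim : ∀ {Act} {𝒞 : ConfStruct Act} → IsWHBisim 𝒞 𝒞 _≡_
  identity-bisim {𝒞 = 𝒞} = record
    { root = λ X Y → Steps.empty-unique 𝒞
    ; iso = λ { X .X refl → ⤖-id _ , (λ _ → refl) , (λ _ _ → ⇔-id _) }
    ; forth = λ { X .X refl a X' s → X' , s , refl }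
    ; back = λ { X .X refl a X' s → X' , s , refl }
    }

  -- EIL_wh formulas are closed, so their truth does not depend on the environment
  wh-env-independent : ∀ {Act} {𝒞 : ConfStruct Act} → Stable 𝒞 →
                       ∀ φ X ρ ρ' → Sat 𝒞 X ρ (embed φ) → Sat 𝒞 X ρ' (embed φ)
  wh-env-independent sC φ X ρ ρ' = Equivalence.to (wh-invariant sC sC identity-bisim φ refl ρ ρ')

  bisimilar⇒≡wh : ∀ {Act} {𝒞 𝒟 : ConfStruct Act} → Stable 𝒞 → Stable 𝒟 → WHBisimilar 𝒞 𝒟 → 𝒞 ≡wh 𝒟
  bisimilar⇒≡wh sC sD (R , B) φ = mk⇔
    (λ (X , X-empty , sat) → let (Y , Y-empty) = Stable.empty sD in
       Y , Y-empty , Equivalence.to (wh-invariant sC sD B φ (IsWHBisim.root B X Y X-empty Y-empty) _ _) sat)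
    (λ (Y , Y-empty , sat) → let (X , X-empty) = Stable.empty sC in
       X , X-empty , Equivalence.from (wh-invariant sC sD B φ (IsWHBisim.root B X Y X-empty Y-empty) _ _) sat)

-- A is truth of formulas on one side, B c their truth on the
-- other side for a candidate c; the formulas of interest (Good) contain a truth constant
-- and are closed under conjunction and negation.
module Separation (em : ExcludedMiddle 0ℓ) {F : Set} (Good : F → Set)
  (top : F) (_∧_ : F → F → F) (neg : F → F)
  (good-top : Good top) (good-∧ : ∀ {φ ψ} → Good φ → Good ψ → Good (φ ∧ ψ))
  (good-neg : ∀ {φ} → Good φ → Good (neg φ))
  (A : F → Set) (A-top : A top) (A-∧ : ∀ {φ ψ} → A φ → A ψ → A (φ ∧ ψ)) (A-neg : ∀ {φ} → ¬ A φ → A (neg φ))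
  {Cand : Set} (B : Cand → F → Set)
  (B-∧ : ∀ {c φ ψ} → B c (φ ∧ ψ) → B c φ × B c ψ) (B-neg : ∀ {c φ} → B c φ → ¬ B c (neg φ)) where
  open Classical em using (dne)

  Agree : Cand → Set
  Agree c = ∀ φ → Good φ → A φ ⇔ B c φ

  separating-formula : ∀ c → ¬ Agree c → ∃[ φ ] (Good φ × A φ × ¬ B c φ)
  separating-formula c disagree = dne λ none → disagree λ φ good → mk⇔
    (λ a → dne λ ¬b → none (φ , good , a , ¬b))
    (λ b → dne λ ¬a → none (neg φ , good-neg good , A-neg ¬a , B-neg b))

  separating-conjunction : (Candidate : Cand → Set) → (∀ c → Candidate c → ¬ Agree c) →
                           ∀ l → ∃[ φ ] (Good φ × A φ × (∀ c → c ∈ₗ l → Candidate c → ¬ B c φ))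
  separating-conjunction Candidate disagree [] = top , good-top , A-top , λ _ ()
  separating-conjunction Candidate disagree (c ∷ l) with separating-conjunction Candidate disagree l | em {Candidate c}
  ... | φ , good , a , refutes | no ¬candidate =
    φ , good , a , λ { _ (here refl) candidate → ⊥-elim (¬candidate candidate) ; c' (there m) → refutes c' m }
  ... | φ , good , a , refutes | yes candidate with separating-formula c (disagree c candidate)
  ... | ψ , good' , a' , ¬b =
    ψ ∧ φ , good-∧ good' good , A-∧ a' a ,
    λ { _ (here refl) _ b → ¬b (proj₁ (B-∧ b)) ; c' (there m) candidate' b → refutes c' m candidate' (proj₂ (B-∧ b)) }

Bound : ∀ {Act} (𝒞 : ConfStruct Act) → Semantics.Env 𝒞 → CS.Conf 𝒞 → Id → Set
Bound 𝒞 ρ X y = ∃[ e ] (ρ y ≡ just e × CS._∈_ 𝒞 e X)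

bound-value : ∀ {Act} (𝒞 : ConfStruct Act) ρ y {X e} → ρ y ≡ just e → Bound 𝒞 ρ X y → CS._∈_ 𝒞 e X
bound-value 𝒞 ρ y {X} ρy≡e (v , ρy≡v , v∈X) =
  subst (λ z → CS._∈_ 𝒞 z X) (just-injective (trans (sym ρy≡v) ρy≡e)) v∈X

bound-⊆ : ∀ {Act} (𝒞 : ConfStruct Act) ρ y {X Z} → CS._⊆_ 𝒞 Z X → Bound 𝒞 ρ Z y → Bound 𝒞 ρ X y
bound-⊆ _ _ _ Z⊆X (v , ρy≡v , v∈Z) = v , ρy≡v , Z⊆X v v∈Z

Named : ∀ {Act} (𝒞 : ConfStruct Act) → Semantics.Env 𝒞 → (Id → Set) → CS.Ev 𝒞 → Set
Named 𝒞 ρ P e = ∃[ y ] (P y × ρ y ≡ just e)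

RoOver : ∀ {Act} → (Id → Set) → Form Act → Set
RoOver P φ = IsRo φ × (∀ y → y ∈ₗ fi φ → P y)

Paired : ∀ {Act} (𝒞 𝒟 : ConfStruct Act) → CS.Conf 𝒞 → CS.Conf 𝒟 → CS.Ev 𝒞 → CS.Ev 𝒟 → Set
Paired 𝒞 𝒟 X Y e e' = CS._∈_ 𝒞 e X × CS._∈_ 𝒟 e' Y × CS.ℓ 𝒟 e' ≡ CS.ℓ 𝒞 e

record Match {Act} (𝒞 𝒟 : ConfStruct Act) (X : CS.Conf 𝒞) (ρC : Semantics.Env 𝒞)
             (Y : CS.Conf 𝒟) (ρD : Semantics.Env 𝒟) (P : Id → Set) : Set where
  field
    paired : Corresponding 𝒞 𝒟 (Paired 𝒞 𝒟 X Y) ρC ρD P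
    agree  : ∀ φ → RoOver P φ → Sat 𝒞 X ρC φ ⇔ Sat 𝒟 Y ρD φ

  boundC : ∀ y → P y → Bound 𝒞 ρC X y
  boundC y Py = let (e , _ , ρCy , _ , e∈X , _) = paired y Py in e , ρCy , e∈X

  boundD : ∀ y → P y → Bound 𝒟 ρD Y y
  boundD y Py = let (_ , e' , _ , ρDy , _ , e'∈Y , _) = paired y Py in e' , ρDy , e'∈Y

Match-sym : ∀ {Act} {𝒞 𝒟 : ConfStruct Act} {X ρC Y ρD P} → Match 𝒞 𝒟 X ρC Y ρD P → Match 𝒟 𝒞 Y ρD X ρC P
Match-sym M = record
  { paired = λ y Py → let (e , e' , ρCy , ρDy , e∈X , e'∈Y , ℓe') = paired y Py in
      e' , e , ρDy , ρCy , e'∈Y , e∈X , sym ℓe'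
  ; agree = λ φ over → ⇔-sym (agree φ over) }
  where open Match M

Match-weaken : ∀ {Act} {𝒞 𝒟 : ConfStruct Act} {X ρC Y ρD P Q} → (∀ y → Q y → P y) →
               Match 𝒞 𝒟 X ρC Y ρD P → Match 𝒞 𝒟 X ρC Y ρD Q
Match-weaken Q⊆P M = record
  { paired = λ y Qy → paired y (Q⊆P y Qy)
  ; agree = λ φ (ro , free) → agree φ (ro , λ y m → Q⊆P y (free y m)) }
  where open Match M

-- a tautology whose only free identifier is y; ⟪ x ⟫ mentions y transfers boundness of y
mentions : ∀ {Act} → Id → Form Act
mentions y = ¬' ((⟪ y ⟫ tt) ∧' (¬' (⟪ y ⟫ tt)))

mentions-over : ∀ {Act} {P : Id → Set} {y} → P y → RoOver P (mentions {Act} y)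
mentions-over Py = (tt , tt) , λ { _ (here refl) → Py ; _ (there (here refl)) → Py }

mentions-holds : ∀ {Act} {𝒞 : ConfStruct Act} {X ρ} y → Sat 𝒞 X ρ (mentions y)
mentions-holds y (sat , ¬sat) = ¬sat sat

undo-transfer : ∀ {Act} {𝒞 𝒟 : ConfStruct Act} {X ρC Y ρD P} → Match 𝒞 𝒟 X ρC Y ρD P →
                ∀ {x e e' X' Y'} → P x → ρC x ≡ just e → CS._⟶[_]_ 𝒞 X' e X →
                ρD x ≡ just e' → CS._⟶[_]_ 𝒟 Y' e' Y →
                ∀ φ → RoOver P φ → All (Bound 𝒞 ρC X') (fi φ) → Sat 𝒞 X' ρC φ →
                All (Bound 𝒟 ρD Y') (fi φ) × Sat 𝒟 Y' ρD φ
undo-transfer {𝒟 = 𝒟} M {x} Px ρCx s ρDx s' φ (ro , free) perm sat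
  with Equivalence.to (Match.agree M (⟪ x ⟫ φ) (ro , λ { _ (here refl) → Px ; y (there m) → free y m }))
                      (_ , _ , s , ρCx , perm , sat)
... | Y'' , e'' , s'' , ρDx'' , perm'' , sat'' with just-injective (trans (sym ρDx'') ρDx)
... | refl with Steps.step-source-unique 𝒟 s'' s'
... | refl = perm'' , sat''

match-undo : ∀ {Act} {𝒞 𝒟 : ConfStruct Act} {X ρC Y ρD P} → Match 𝒞 𝒟 X ρC Y ρD P →
             ∀ {x e X'} → P x → ρC x ≡ just e → CS._⟶[_]_ 𝒞 X' e X →
             ∃[ Y' ] ∃[ e' ] (ρD x ≡ just e' × CS._⟶[_]_ 𝒟 Y' e' Y ×
               Match 𝒞 𝒟 X' ρC Y' ρD (λ y → P y × Bound 𝒞 ρC X' y) ×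
               (∀ y → P y → Bound 𝒟 ρD Y' y → Bound 𝒞 ρC X' y))
match-undo {Act} {𝒞} {𝒟} {X} {ρC} {Y} {ρD} {P} M {x} {e} {X'} Px ρCx s
  with Equivalence.to (Match.agree M (⟪ x ⟫ tt) (tt , λ { _ (here refl) → Px })) (X' , e , s , ρCx , [] , tt)
... | Y' , e' , s' , ρDx , _ = Y' , e' , ρDx , s' , M' , right-to-left
  where
  open Match M
  left-to-right : ∀ y → P y → Bound 𝒞 ρC X' y → Bound 𝒟 ρD Y' y
  left-to-right y Py b =
    All.head (proj₁ (undo-transfer M Px ρCx s ρDx s' (mentions y) (mentions-over {Act} {P} Py) (b ∷ b ∷ [])
                     (mentions-holds {𝒞 = 𝒞} y)))
  right-to-left : ∀ y → P y → Bound 𝒟 ρD Y' y → Bound 𝒞 ρC X' y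
  right-to-left y Py b =
    All.head (proj₁ (undo-transfer (Match-sym M) Px ρDx s' ρCx s (mentions y) (mentions-over {Act} {P} Py) (b ∷ b ∷ [])
                     (mentions-holds {𝒞 = 𝒟} y)))
  M' : Match 𝒞 𝒟 X' ρC Y' ρD (λ y → P y × Bound 𝒞 ρC X' y)
  M' = record
    { paired = λ y (Py , b) → let (v , v' , ρCy , ρDy , _ , _ , ℓv') = paired y Py in
        v , v' , ρCy , ρDy , bound-value 𝒞 ρC y ρCy b , bound-value 𝒟 ρD y ρDy (left-to-right y Py b) , ℓv'
    ; agree = λ φ (ro , free) → mk⇔
        (λ sat → proj₂ (undo-transfer M Px ρCx s ρDx s' φ (ro , λ y m → proj₁ (free y m))
                          (All.tabulate λ m → proj₂ (free _ m)) sat))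
        (λ sat → proj₂ (undo-transfer (Match-sym M) Px ρDx s' ρCx s φ (ro , λ y m → proj₁ (free y m))
                          (All.tabulate λ m → let (Py , b) = free _ m in left-to-right _ Py b) sat))
    }

AllNamed : ∀ {Act} (𝒞 : ConfStruct Act) → Semantics.Env 𝒞 → (Id → Set) → CS.Conf 𝒞 → Set
AllNamed 𝒞 ρ P X = ∀ e → CS._∈_ 𝒞 e X → Named 𝒞 ρ P e

descend : ∀ {Act} {𝒞 𝒟 : ConfStruct Act} {X Z} → Steps.Descent 𝒞 X Z →
          ∀ {ρC Y ρD P} → Match 𝒞 𝒟 X ρC Y ρD P → AllNamed 𝒞 ρC P X →
          ∃[ YZ ] (CS._⊆_ 𝒟 YZ Y × Match 𝒞 𝒟 Z ρC YZ ρD (λ y → P y × Bound 𝒞 ρC Z y) ×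
                   (∀ y → P y → Bound 𝒟 ρD YZ y → Bound 𝒞 ρC Z y) ×
                   (∀ g → CS._∈_ 𝒟 g Y → CS._∈_ 𝒟 g YZ ⊎ Named 𝒟 ρD P g))
descend Steps.stop {Y = Y} M _ =
  Y , (λ _ g∈Y → g∈Y) , Match-weaken (λ _ → proj₁) M , (λ y Py _ → Match.boundC M y Py) , λ _ → inj₁
descend {𝒞 = 𝒞} {𝒟} (Steps._◅_ {X' = X'} s r) {ρC} {Y} {ρD} {P} M named with named _ (Steps.step-new 𝒞 s)
... | x , Px , ρCx with match-undo M Px ρCx s
... | Y' , e' , ρDx , s' , M' , back with descend r M' named'
  where
  named' : AllNamed 𝒞 ρC (λ y → P y × Bound 𝒞 ρC X' y) X'
  named' e e∈X' = let (y , Py , ρCy) = named e (Steps.step-⊆ 𝒞 s e e∈X') in y , (Py , e , ρCy , e∈X') , ρCy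
... | YZ , YZ⊆Y' , MZ , backZ , coverZ =
  YZ , (λ h h∈YZ → Steps.step-⊆ 𝒟 s' h (YZ⊆Y' h h∈YZ)) ,
  Match-weaken (λ y (Py , bZ) → (Py , bound-⊆ 𝒞 ρC y (Steps.descent-⊆ 𝒞 r) bZ) , bZ) MZ ,
  (λ y Py b → backZ y (Py , back y Py (bound-⊆ 𝒟 ρD y YZ⊆Y' b)) b) ,
  cover
  where
  cover : ∀ h → CS._∈_ 𝒟 h Y → CS._∈_ 𝒟 h YZ ⊎ Named 𝒟 ρD P h
  cover h h∈Y with proj₁ (proj₂ s' h) h∈Y
  ... | inj₂ refl = inj₂ (x , Px , ρDx)
  ... | inj₁ h∈Y' with coverZ h h∈Y'
  ...   | inj₁ h∈YZ = inj₁ h∈YZ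
  ...   | inj₂ (y , (Py , _) , ρDy) = inj₂ (y , Py , ρDy)

EqWH : ∀ {Act} (𝒞 : ConfStruct Act) → CS.Conf 𝒞 → (𝒟 : ConfStruct Act) → CS.Conf 𝒟 → Set
EqWH 𝒞 X 𝒟 Y = ∀ φ → Sat 𝒞 X (Semantics.ρ∅ 𝒞) (embed φ) ⇔ Sat 𝒟 Y (Semantics.ρ∅ 𝒟) (embed φ)

below-zero-empty : (l : List Id) → (∀ y → y ∈ₗ l → y < 0) → l ≡ []
below-zero-empty [] _ = refl
below-zero-empty (y ∷ _) below with below y (here refl)
... | ()

RoOver-∧ : ∀ {Act} {P : Id → Set} {φ ψ : Form Act} → RoOver P φ → RoOver P ψ → RoOver P (φ ∧' ψ)
RoOver-∧ {φ = φ} (roφ , freeφ) (roψ , freeψ) = (roφ , roψ) , λ y m → [ freeφ y , freeψ y ] (∈-++⁻ (fi φ) m)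

RoOver-binder : ∀ {Act} {P : Id → Set} {x a} {φ : Form Act} → RoOver (λ y → y ≡ x ⊎ P y) φ → RoOver P ([ x ∶ a ] φ)
RoOver-binder {x = x} {φ = φ} (ro , free) = ro , λ y m →
  let (y∈φ , y≢x) = ∈-filter⁻ (λ z → ¬? (z ≟ x)) {xs = fi φ} m
  in [ (λ y≡x → ⊥-elim (y≢x y≡x)) , (λ Py → Py) ] (free y y∈φ)

module _ (em : ExcludedMiddle 0ℓ) where
  open Classical em using (dne)

  -- A matching extends by a name x for any event e of X. Otherwise every equally labelled
  -- event d of Y is refuted by a formula over P and x true of e; their conjunction χ,
  -- under the binder [ x ∶ ℓ e ], is a formula over P true of X but false of Y
  match-extend : ∀ {Act} {𝒞 𝒟 : ConfStruct Act} {X ρC Y ρD P} → Match 𝒞 𝒟 X ρC Y ρD P →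
                 ∀ x {e} → CS._∈_ 𝒞 e X →
                 ∃[ e' ] Match 𝒞 𝒟 X (Semantics._[_↦_] 𝒞 ρC x e) Y (Semantics._[_↦_] 𝒟 ρD x e')
                                (λ y → y ≡ x ⊎ P y)
  match-extend {Act} {𝒞} {𝒟} {X} {ρC} {Y} {ρD} {P} M x {e} e∈X = dne λ none →
    let (l , spec) = CS.finite 𝒟 Y
        (χ , over , sat , refutes) = separating-conjunction Candidate (λ d cand agrees → none (d , extended cand agrees)) l
        (d , d∈Y , ℓd , satd) = Equivalence.to (agree ([ x ∶ CS.ℓ 𝒞 e ] χ) (RoOver-binder {P = P} {a = CS.ℓ 𝒞 e} {φ = χ} over))
                                               (e , e∈X , refl , sat)
    in refutes d (proj₁ (spec d) d∈Y) (d∈Y , ℓd) satd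
    where
    open Match M
    module SC = Semantics 𝒞
    module SD = Semantics 𝒟
    Candidate : CS.Ev 𝒟 → Set
    Candidate d = CS._∈_ 𝒟 d Y × CS.ℓ 𝒟 d ≡ CS.ℓ 𝒞 e
    open Separation em (RoOver (λ y → y ≡ x ⊎ P y)) tt _∧'_ ¬'_
                    (tt , λ _ ()) (λ {φ} {ψ} → RoOver-∧ {φ = φ} {ψ}) (λ over → over)
                    (Sat 𝒞 X (ρC SC.[ x ↦ e ])) tt _,_ (λ ¬sat → ¬sat)
                    (λ d → Sat 𝒟 Y (ρD SD.[ x ↦ d ])) (λ sat → sat) (λ sat ¬sat → ¬sat sat)
    extended : ∀ {d} → Candidate d → Agree d →
               Match 𝒞 𝒟 X (ρC SC.[ x ↦ e ]) Y (ρD SD.[ x ↦ d ]) (λ y → y ≡ x ⊎ P y)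
    extended (d∈Y , ℓd) agrees = record
      { paired = corresponding-update {𝒞 = 𝒞} {𝒟} x (e∈X , d∈Y , ℓd) paired ; agree = agrees }

  name-all : ∀ {Act} {𝒞 𝒟 : ConfStruct Act} {X Y} (l : List (CS.Ev 𝒞)) → (∀ e → e ∈ₗ l → CS._∈_ 𝒞 e X) →
             ∀ k {ρC ρD} → Match 𝒞 𝒟 X ρC Y ρD (_< k) →
             (∀ e → CS._∈_ 𝒞 e X → Named 𝒞 ρC (_< k) e ⊎ e ∈ₗ l) →
             ∃[ k' ] ∃[ ρC' ] ∃[ ρD' ] (Match 𝒞 𝒟 X ρC' Y ρD' (_< k') × AllNamed 𝒞 ρC' (_< k') X)
  name-all [] _ k M covered = k , _ , _ , M , λ e e∈X → [ (λ named → named) , (λ ()) ] (covered e e∈X)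
  name-all {𝒞 = 𝒞} {X = X} (d ∷ l) l⊆X k {ρC} M covered with match-extend M k (l⊆X d (here refl))
  ... | _ , M' = name-all l (λ e m → l⊆X e (there m)) (suc k) (Match-weaken below-suc M') covered'
    where
    below-suc : ∀ y → y < suc k → y ≡ k ⊎ y < k
    below-suc y y<1+k = swap (m<1+n⇒m<n∨m≡n y<1+k)
    covered' : ∀ e → CS._∈_ 𝒞 e X → Named 𝒞 (Semantics._[_↦_] 𝒞 ρC k d) (_< suc k) e ⊎ e ∈ₗ l
    covered' e e∈X with covered e e∈X
    ... | inj₁ (y , y<k , ρCy) = inj₁ (y , m<n⇒m<1+n y<k , trans (Updates.update-other 𝒞 ρC k d (<⇒≢ y<k)) ρCy)
    ... | inj₂ (here refl) = inj₁ (k , n<1+n k , Updates.update-same 𝒞 ρC k d)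
    ... | inj₂ (there m) = inj₂ m

  -- Causality between named events transfers along a matching that names all of Y:
  -- if d ≰ d', some Z ⊆ Y contains d' but not d; descending from Y to Z, the left side
  -- descends to some XZ ⊆ X that contains c', hence c, so y is bound in Z, i.e. d ∈ Z
  order-transfer : ∀ {Act} {𝒞 𝒟 : ConfStruct Act} → Stable 𝒟 → ∀ {X ρC Y ρD P} →
                   Match 𝒞 𝒟 X ρC Y ρD P → AllNamed 𝒟 ρD P Y →
                   ∀ {y y' c c' d d'} → P y → P y' → ρC y ≡ just c → ρC y' ≡ just c' →
                   ρD y ≡ just d → ρD y' ≡ just d' →
                   CS._≤[_]_ 𝒞 c X c' → CS._≤[_]_ 𝒟 d Y d'
  order-transfer {𝒞 = 𝒞} {𝒟} sD {X} {ρC} {Y} {ρD} M namedD {y} {y'} {c} Py Py' ρCy ρCy' ρDy ρDy' c≤c' = dne λ d≰d' →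
    let (Z , Z⊆Y , d'∈Z , d∉Z) = Classical.Causality.≰-witness em 𝒟 d≰d'
        (XZ , XZ⊆X , MZ , back , _) = descend (StableFacts.descent-exists em 𝒟 sD Y Z Z⊆Y) (Match-sym M) namedD
        c'∈XZ = bound-value 𝒞 ρC y' ρCy' (Match.boundD MZ y' (Py' , _ , ρDy' , d'∈Z))
    in d∉Z (bound-value 𝒟 ρD y ρDy (back y Py (c , ρCy , c≤c' XZ XZ⊆X c'∈XZ)))

  NamedPair : ∀ {Act} (𝒞 𝒟 : ConfStruct Act) → Semantics.Env 𝒞 → Semantics.Env 𝒟 → (Id → Set) →
              CS.Ev 𝒞 → CS.Ev 𝒟 → Set
  NamedPair 𝒞 𝒟 ρC ρD P e e' = ∃[ y ] (P y × ρC y ≡ just e × ρD y ≡ just e')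

  -- A matching naming all events of X names all events of Y too: descending from X to
  -- the empty configuration, an unnamed event g of Y would remain, refuted by [ 0 ∶ ℓ g ] tt
  right-named : ∀ {Act} {𝒞 𝒟 : ConfStruct Act} → Stable 𝒞 → ∀ {X ρC Y ρD P} →
                Match 𝒞 𝒟 X ρC Y ρD P → AllNamed 𝒞 ρC P X → AllNamed 𝒟 ρD P Y
  right-named {𝒞 = 𝒞} {𝒟} sC {X} M namedC g g∈Y
    with Stable.empty sC
  ... | E , E-empty with descend (StableFacts.descent-exists em 𝒞 sC X E (λ h h∈E → ⊥-elim (E-empty h h∈E))) M namedC
  ... | YE , _ , ME , _ , cover with cover g g∈Y
  ... | inj₂ named = named
  ... | inj₁ g∈YE with Equivalence.from (Match.agree ME ([ 0 ∶ CS.ℓ 𝒟 g ] tt) (tt , λ _ ())) (g , g∈YE , refl , tt)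
  ... | e , e∈E , _ = ⊥-elim (E-empty e e∈E)

  Match⇒EventIso : ∀ {Act} {𝒞 𝒟 : ConfStruct Act} → Stable 𝒞 → Stable 𝒟 → ∀ {X ρC Y ρD P} →
                   Match 𝒞 𝒟 X ρC Y ρD P → AllNamed 𝒞 ρC P X → EventIso 𝒞 𝒟 X Y (NamedPair 𝒞 𝒟 ρC ρD P)
  Match⇒EventIso {𝒞 = 𝒞} {𝒟} sC sD {X} {ρC} {Y} {ρD} {P} M namedC = record
    { domain = λ (y , Py , ρCy , ρDy) → bound-value 𝒞 ρC y ρCy (boundC y Py) , bound-value 𝒟 ρD y ρDy (boundD y Py)
    ; total = λ e e∈X → let (y , Py , ρCy) = namedC e e∈X ; (e' , ρDy , _) = boundD y Py in e' , y , Py , ρCy , ρDy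
    ; onto = λ e' e'∈Y → let (y , Py , ρDy) = namedD e' e'∈Y ; (e , ρCy , _) = boundC y Py in e , y , Py , ρCy , ρDy
    ; function = λ (y , Py , ρCy , ρDy) (y' , Py' , ρCy' , ρDy') →
        StableFacts.≤-antisym em 𝒟 sD (bound-value 𝒟 ρD y ρDy (boundD y Py)) (bound-value 𝒟 ρD y' ρDy' (boundD y' Py'))
          (order-transfer sD M namedD Py Py' ρCy ρCy' ρDy ρDy' (Steps.≤-reflexive 𝒞 refl))
          (order-transfer sD M namedD Py' Py ρCy' ρCy ρDy' ρDy (Steps.≤-reflexive 𝒞 refl))
    ; injective = λ (y , Py , ρCy , ρDy) (y' , Py' , ρCy' , ρDy') →
        StableFacts.≤-antisym em 𝒞 sC (bound-value 𝒞 ρC y ρCy (boundC y Py)) (bound-value 𝒞 ρC y' ρCy' (boundC y' Py'))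
          (order-transfer sC (Match-sym M) namedC Py Py' ρDy ρDy' ρCy ρCy' (Steps.≤-reflexive 𝒟 refl))
          (order-transfer sC (Match-sym M) namedC Py' Py ρDy' ρDy ρCy' ρCy (Steps.≤-reflexive 𝒟 refl))
    ; labels = λ (y , Py , ρCy , ρDy) → let (v , v' , ρCy≡v , ρDy≡v' , _ , _ , ℓv') = paired y Py in
        subst₂ (λ u u' → CS.ℓ 𝒟 u' ≡ CS.ℓ 𝒞 u) (just-injective (trans (sym ρCy≡v) ρCy))
               (just-injective (trans (sym ρDy≡v') ρDy)) ℓv'
    ; order = λ (y , Py , ρCy , ρDy) (y' , Py' , ρCy' , ρDy') → mk⇔
        (order-transfer sD M namedD Py Py' ρCy ρCy' ρDy ρDy')
        (order-transfer sC (Match-sym M) namedC Py Py' ρDy ρDy' ρCy ρCy')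
    }
    where
    open Match M
    namedD : AllNamed 𝒟 ρD P Y
    namedD = right-named sC M namedC

  -- EIL_wh-equivalent configurations are isomorphic: match all events of X one by one,
  -- starting from the empty matching, which holds as closed EIL_ro formulas are in EIL_wh
  EqWH⇒≅ : ∀ {Act} {𝒞 𝒟 : ConfStruct Act} → Stable 𝒞 → Stable 𝒟 →
           ∀ X Y → EqWH 𝒞 X 𝒟 Y → 𝒞 ∣ X ≅ 𝒟 ∣ Y
  EqWH⇒≅ {𝒞 = 𝒞} {𝒟} sC sD X Y eq with CS.finite 𝒞 X
  ... | l , spec with name-all l (λ e m → proj₂ (spec e) m) 0 initial (λ e e∈X → inj₂ (proj₁ (spec e) e∈X))
    where
    initial : Match 𝒞 𝒟 X (Semantics.ρ∅ 𝒞) Y (Semantics.ρ∅ 𝒟) (_< 0)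
    initial = record { paired = λ y () ; agree = λ φ (ro , free) → eq (rc φ ro (below-zero-empty (fi φ) free)) }
  ... | _ , _ , _ , M , named = Isomorphisms.EventIso⇒≅ em 𝒞 𝒟 (Match⇒EventIso sC sD M named)

  -- The forth condition: otherwise each a-successor Y'' of Y is refuted by a formula true
  -- of X'; by image finiteness finitely many Y'' occur, and ⟨ a ⟩ of their conjunction
  -- holds for X but not for Y
  EqWH-forth : ∀ {Act} {𝒞 𝒟 : ConfStruct Act} → Stable 𝒞 → Stable 𝒟 → ImageFinite 𝒟 →
               ∀ {X Y} → EqWH 𝒞 X 𝒟 Y →
               ∀ a X' → CS._⟶⟨_⟩_ 𝒞 X a X' → ∃[ Y' ] (CS._⟶⟨_⟩_ 𝒟 Y a Y' × EqWH 𝒞 X' 𝒟 Y')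
  EqWH-forth {Act} {𝒞} {𝒟} sC sD finD {X} {Y} eq a X' (e , s , ℓe) = dne λ none →
    let (L , complete) = finD Y a
        (ψ , _ , sat , refutes) = separating-conjunction (CS._⟶⟨_⟩_ 𝒟 Y a)
                                    (λ Y'' step agrees → none (Y'' , step , λ φ → agrees φ tt)) L
        (Y'' , e' , s' , ℓe' , sat'') = Equivalence.to (eq (⟨ a ⟩ ψ)) (X' , e , s , ℓe , wh-env-independent em sC ψ X' _ _ sat)
    in refutes Y'' (complete Y'' (e' , s' , ℓe')) (e' , s' , ℓe') (wh-env-independent em sD ψ Y'' _ _ sat'')
    where
    open Separation em {FormWH Act} (λ _ → ⊤) tt _∧'_ ¬'_ tt (λ _ _ → tt) (λ _ → tt)
                    (λ ψ → Sat 𝒞 X' (Semantics.ρ∅ 𝒞) (embed ψ)) tt _,_ (λ ¬sat → ¬sat)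
                    (λ Y'' ψ → Sat 𝒟 Y'' (Semantics.ρ∅ 𝒟) (embed ψ)) (λ sat → sat) (λ sat ¬sat → ¬sat sat)

  ≡wh⇒bisimilar : ∀ {Act} {𝒞 𝒟 : ConfStruct Act} → Stable 𝒞 → Stable 𝒟 → ImageFinite 𝒞 → ImageFinite 𝒟 →
                  𝒞 ≡wh 𝒟 → WHBisimilar 𝒞 𝒟
  ≡wh⇒bisimilar {𝒞 = 𝒞} {𝒟} sC sD finC finD equivalent = (λ X Y → EqWH 𝒞 X 𝒟 Y) , record
    { root = λ X Y X-empty Y-empty φ → mk⇔
        (λ sat → let (Y'' , Y''-empty , sat'') = Equivalence.to (equivalent φ) (X , X-empty , sat) in
                 subst (λ W → Sat 𝒟 W _ (embed φ)) (Steps.empty-unique 𝒟 Y''-empty Y-empty) sat'')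
        (λ sat → let (X'' , X''-empty , sat'') = Equivalence.from (equivalent φ) (Y , Y-empty , sat) in
                 subst (λ W → Sat 𝒞 W _ (embed φ)) (Steps.empty-unique 𝒞 X''-empty X-empty) sat'')
    ; iso = EqWH⇒≅ sC sD
    ; forth = λ X Y → EqWH-forth sC sD finD
    ; back = λ X Y eq a Y' s → let (X' , s' , eq') = EqWH-forth sD sC finC (λ φ → ⇔-sym (eq φ)) a Y' s
                               in X' , s' , λ φ → ⇔-sym (eq' φ)
    }

theorem3 : ExcludedMiddle 0ℓ → {Act : Set} (𝒞 𝒟 : ConfStruct Act) →
    Stable 𝒞 → Stable 𝒟 → ImageFinite 𝒞 → ImageFinite 𝒟 →
    WHBisimilar 𝒞 𝒟 ⇔ (𝒞 ≡wh 𝒟)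
theorem3 em 𝒞 𝒟 sC sD finC finD = mk⇔ (bisimilar⇒≡wh em sC sD) (≡wh⇒bisimilar em sC sD finC finD)
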